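{- Let $n\ge 1$ and let $x_j^i\ge 2$ be integers for each $j=1,\dots,n$ and each $i=1,\dots,n+1$. For $1\le k\le n$ and $\{i_1<\dots<i_{k+1}\}\subseteq\{1,\dots,n+1\}$ define the set $$X_k(i_1,\dots,i_{k+1})=\left\{\frac{x_k^{i_1}\cdots x_k^{i_{k+1}}}{x_k^{i_{k+1}}},\dots,\frac{x_k^{i_1}\cdots x_k^{i_{k+1}}}{x_k^{i_1}}\right\},$$ i.e. the set of the $k+1$ products obtained from $x_k^{i_1}\cdots x_k^{i_{k+1}}$ by omitting one factor. Suppose that $\gcd(X_k(i_1,\dots,i_{k+1}))=1$ for every $1\le k\le n$ and every $\{i_1<\dots<i_{k+1}\}\subseteq\{1,\dots,n+1\}$, and let $$g_n=\max_{1\le k\le n}\max\{\,g(X_k(i_1,\dots,i_{k+1}))\;:\;\{i_1<\dots<i_{k+1}\}\subseteq\{1,\dots,n+1\}\,\}.$$ Then for all positive integers $a_1,\dots,a_n$ with $a_j>g_n$ for every $1\le j\le n$, the $n$-dimensional rectangle $(a_1\times\cdots\times a_n)$ can be tiled with the bricks $X^i=(x_1^i\times\cdots\times x_n^i)$, $i=1,\dots,n+1$.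
   Context: For positive integers $a_1,\dots,a_n$, $(a_1\times\cdots\times a_n)$ denotes the $n$-dimensional rectangle $\{(y_1,\dots,y_n)\in\mathbb{R}^n: 0\le y_i\le a_i\}$. A rectangle $A$ is tiled with bricks (smaller $n$-dimensional rectangles) $B_1,\dots,B_k$ if $A$ is the union of finitely many copies of the $B_i$ (translated, and rotations allowed) with pairwise disjoint interiors. For a finite set $S$ of positive integers with $\gcd(S)=1$, the Frobenius number $g(S)$ is the largest integer that is not representable as a nonnegative integer combination of the elements of $S$. -}

module Defs where

open import Data.Nat using (ℕ; zero; suc; _+_; _*_; _≤_; _<_)
open import Data.Nat.GCD using (gcd)
open import Data.Fin using (Fin; toℕ; punchIn) renaming (_<_ to _<ᶠ_)
open import Data.Fin.Permutation using (Permutation′; _⟨$⟩ʳ_)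
open import Data.List using (List; foldr; map; allFin)
open import Data.Product using (Σ; ∃; _×_)
open import Relation.Binary.PropositionalEquality using (_≡_)
open import Relation.Nullary using (¬_)

prodFin : (m : ℕ) → (Fin m → ℕ) → ℕ
prodFin zero    f = 1
prodFin (suc m) f = f Fin.zero * prodFin m (λ s → f (Fin.suc s))
  where import Data.Fin as Fin

gcdList : List ℕ → ℕ
gcdList = foldr gcd 0

Representable : List ℕ → ℕ → Set
Representable S t = Σ (List ℕ) λ c → foldr _+_ 0 (Data.List.zipWith _*_ c S) ≡ t
  where import Data.List

IsFrobenius : List ℕ → ℕ → Set
IsFrobenius S f = ¬ Representable S f × (∀ t → f < t → Representable S t)

-- strictly increasing map Fin (suc m) → Fin N, i.e. a (suc m)-subset i₁ < … < i_{m+1}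
StrictlyIncreasing : {m N : ℕ} → (Fin m → Fin N) → Set
StrictlyIncreasing {m} I = ∀ (r s : Fin m) → r <ᶠ s → I r <ᶠ I s

-- Brick data: x j i = x_j^i, j ∈ {1..n} (as Fin n), i ∈ {1..n+1} (as Fin (suc n)).
-- For the paper's k (1 ≤ k ≤ n) we use kk : Fin n with k = suc (toℕ kk).
Xset : {n : ℕ} → (Fin n → Fin (suc n) → ℕ) → (kk : Fin n) →
       (Fin (suc (suc (toℕ kk))) → Fin (suc n)) → List ℕ
Xset x kk I = map (λ r → prodFin (suc (toℕ kk)) (λ s → x kk (I (punchIn r s))))
                  (allFin (suc (suc (toℕ kk))))

record Placed (n : ℕ) : Set where
  field
    brick  : Fin (suc n)
    rot    : Permutation′ n
    corner : Fin n → ℕ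

side : {n : ℕ} → (Fin n → Fin (suc n) → ℕ) → Placed n → Fin n → ℕ
side x P j = x (Placed.rot P ⟨$⟩ʳ j) (Placed.brick P)

CellIn : {n : ℕ} → (Fin n → Fin (suc n) → ℕ) → Placed n → (Fin n → ℕ) → Set
CellIn x P c = ∀ j → (Placed.corner P j ≤ c j) × (c j < Placed.corner P j + side x P j)

Tiles : {n : ℕ} → (Fin n → Fin (suc n) → ℕ) → (a : Fin n → ℕ) →
        (m : ℕ) → (Fin m → Placed n) → Set
Tiles {n} x a m P =
  (∀ (t : Fin m) (j : Fin n) → Placed.corner (P t) j + side x (P t) j ≤ a j) ×
  (∀ (c : Fin n → ℕ) → (∀ j → c j < a j) →
     ∃ λ (t : Fin m) → CellIn x (P t) c) ×
  (∀ (c : Fin n → ℕ) (t u : Fin m) → CellIn x (P t) c → CellIn x (P u) c → t ≡ u)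

Tileable : {n : ℕ} → (Fin n → Fin (suc n) → ℕ) → (Fin n → ℕ) → Set
Tileable x a = ∃ λ m → Σ (Fin m → Placed _) λ P → Tiles x a m P

{-# OPTIONS --safe #-}
-- Induction on the dimension, splitting off the paper's last axis, the only one whose
-- hypothesis involves all n + 1 bricks.  As a_n exceeds the Frobenius number of the
-- cofactors P_r = ∏_{i ≠ r} x_n^i, it is a sum Σ_r c_r P_r.  A slab of thickness P_r
-- over the remaining (n − 1)-dimensional box is tiled by tiling that box with the n
-- bricks other than X^r (induction; their hypotheses are among the original ones) and
-- erecting over each base brick X^i a column of P_r / x_n^i copies of it.  Stacking c_r
-- slabs of thickness P_r for every r fills the box.  A tiling is encoded by how many
-- pieces cover each unit cell, so that stacking amounts to adding indicators.
-- Representability of a_n is obtained constructively: it is decidable, and when the gcd is 1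
-- it holds beyond some bound, so its failure would produce a Frobenius number ≥ a_n.
module Submission where

open import Defs
open import Data.Nat using (ℕ; zero; suc; _+_; _*_; _∸_; _≤_; _<_; z≤n; s≤s; _≤?_; _<?_; _≟_; NonZero)
open import Data.Nat.Properties
open import Data.Nat.DivMod using (_/_; _%_; m≡m%n+[m/n]*n; m%n<n; m*n/n≡m; /-monoˡ-≤)
open import Data.Nat.Divisibility using (_∣_; divides; ∣-trans; m∣m*n; n∣m*n)
open import Data.Nat.GCD using (gcd; gcd-GCD; gcd[m,n]∣m; gcd[m,n]∣n; gcd-identityˡ; gcd-identityʳ; module Bézout)
open import Data.Nat.ListAction using (sum)
open import Data.Nat.ListAction.Properties using (sum-++)
open import Data.Nat.Tactic.RingSolver using (solve-∀)
open import Data.Bool using (true; false; if_then_else_)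
open import Data.Fin using (Fin; zero; suc; toℕ; punchIn; fromℕ; inject₁; opposite) renaming (_<_ to _<ᶠ_)
open import Data.Fin.Properties using (∀-cons-⇔; toℕ-fromℕ; toℕ-inject₁; opposite-involutive)
import Data.Fin.Permutation as Permutation
import Data.Vec.Functional as Vec
open Vec using (tail)
open import Data.List using (List; []; _∷_; _++_; map; zipWith; concatMap; allFin; lookup; length)
open import Data.List.Properties using (map-++)
open import Data.List.Relation.Unary.All using (All; []; _∷_)
import Data.List.Relation.Unary.All.Properties as All
open import Data.Product using (∃; ∃₂; _×_; _,_; proj₁; proj₂)
open import Data.Sum using (inj₁; inj₂)
open import Data.Unit using (⊤; tt)
open import Function using (_∘_; id)
open import Relation.Nullary using (¬_; Dec; does; yes; no; _because_; contradiction)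
open import Relation.Nullary.Decidable using (map′; _×-dec_) renaming (map to Dec-map)
open import Relation.Unary using (Decidable)
open import Relation.Binary.PropositionalEquality

-- Numerical semigroups

representable-∷⁻ : ∀ {s S t} → Representable (s ∷ S) t →
                   ∃ λ j → j < suc t × j * s ≤ t × Representable S (t ∸ j * s)
representable-∷⁻ ([] , e) = 0 , s≤s z≤n , z≤n , [] , e
representable-∷⁻ {zero} {S} (j ∷ c , e) =
  0 , s≤s z≤n , z≤n , c , trans (cong (_+ sum (zipWith _*_ c S)) (sym (*-zeroʳ j))) e
representable-∷⁻ {suc s} {S} {t} (j ∷ c , e) =
  j , s≤s (≤-trans (m≤m*n j (suc s)) js≤t) , js≤t , c ,
  trans (sym (m+n∸m≡n (j * suc s) _)) (cong (_∸ j * suc s) e)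
  where
  js≤t : j * suc s ≤ t
  js≤t = subst (j * suc s ≤_) e (m≤m+n _ _)

representable? : ∀ S t → Dec (Representable S t)
representable? []      t = map′ (λ t≡0 → [] , sym t≡0) 0≡t (t ≟ 0)
  where
  0≡t : Representable [] t → t ≡ 0
  0≡t ([]    , e) = sym e
  0≡t (_ ∷ _ , e) = sym e
representable? (s ∷ S) t =
  map′ join representable-∷⁻
       (anyUpTo? (λ j → (j * s ≤? t) ×-dec representable? S (t ∸ j * s)) (suc t))
  where
  join : (∃ λ j → j < suc t × j * s ≤ t × Representable S (t ∸ j * s)) → Representable (s ∷ S) t
  join (j , _ , js≤t , c , e) = j ∷ c , trans (cong (j * s +_) e) (m+[n∸m]≡n js≤t)

CombinesEventually : (d u v K : ℕ) → Set
CombinesEventually d u v K =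
  ∃ λ N → ∀ t → N < t → ∃₂ λ α β → K < α × K < β × t * d ≡ α * u + β * v

combinesEventually-comm : ∀ {d u v K} → CombinesEventually d u v K → CombinesEventually d v u K
combinesEventually-comm {d} {u} {v} {K} (N , large) = N , swapped
  where
  swapped : ∀ t → N < t → ∃₂ λ α β → K < α × K < β × t * d ≡ α * v + β * u
  swapped t N<t with large t N<t
  ... | α , β , K<α , K<β , eq = β , α , K<β , K<α , trans eq (+-comm (α * u) (β * v))

-- Write t = r + q b with r < b; the Bézout relation turns r into r x a − r y b, and K + 1
-- copies of a b are moved from the b-coefficient to the a-coefficient to make both large.
coprime-combinesEventually : ∀ {a b x y} d → 1 + y * b ≡ x * a → .{{NonZero b}} →
                             ∀ K → CombinesEventually d (a * d) (b * d) K
coprime-combinesEventually {a} {b} {x} {y} d bézout K = Q * b , large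
  where
  Q : ℕ
  Q = b * y + suc K * a + suc K
  large : ∀ t → Q * b < t → ∃₂ λ α β → K < α × K < β × t * d ≡ α * (a * d) + β * (b * d)
  large t Qb<t = α , β , K<α , K<β , scaled
    where
    r q X α β : ℕ
    r = t % b
    q = t / b
    X = r * y + suc K * a
    α = r * x + suc K * b
    β = q ∸ X
    X+K<q : X + suc K ≤ q
    X+K<q = begin
      r * y + suc K * a + suc K ≤⟨ +-monoˡ-≤ (suc K) (+-monoˡ-≤ (suc K * a) (*-monoˡ-≤ y (<⇒≤ (m%n<n t b)))) ⟩
      b * y + suc K * a + suc K ≡⟨ m*n/n≡m Q b ⟨
      Q * b / b                 ≤⟨ /-monoˡ-≤ b (<⇒≤ Qb<t) ⟩
      q                         ∎
      where open ≤-Reasoning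
    q≡X+β : q ≡ X + β
    q≡X+β = sym (m+[n∸m]≡n (≤-trans (m≤m+n X (suc K)) X+K<q))
    K<β : K < β
    K<β = +-cancelˡ-≤ X (suc K) β (subst (X + suc K ≤_) q≡X+β X+K<q)
    K<α : K < α
    K<α = ≤-trans (m≤m*n (suc K) b) (m≤n+m (suc K * b) (r * x))
    scaled : t * d ≡ α * (a * d) + β * (b * d)
    scaled = begin
      t * d                                               ≡⟨ cong (_* d) (m≡m%n+[m/n]*n t b) ⟩
      (r + q * b) * d                                     ≡⟨ cong (λ z → (r + z * b) * d) q≡X+β ⟩
      (r + (r * y + suc K * a + β) * b) * d               ≡⟨ expand r y (suc K) a β b d ⟩
      r * ((1 + y * b) * d) + (suc K * b * a + β * b) * d ≡⟨ cong (λ z → r * (z * d) + rest) bézout ⟩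
      r * (x * a * d) + (suc K * b * a + β * b) * d       ≡⟨ regroup r x a (suc K) b β d ⟩
      α * (a * d) + β * (b * d)                           ∎
      where
      open ≡-Reasoning
      rest : ℕ
      rest = (suc K * b * a + β * b) * d
      expand : ∀ r y s a β b d →
               (r + (r * y + s * a + β) * b) * d ≡ r * ((1 + y * b) * d) + (s * b * a + β * b) * d
      expand = solve-∀
      regroup : ∀ r x a s b β d →
                r * (x * a * d) + (s * b * a + β * b) * d ≡ (r * x + s * b) * (a * d) + β * (b * d)
      regroup = solve-∀

bézout-combinesEventually : ∀ {d u v x y} → d ∣ u → d ∣ v → .{{NonZero v}} →
                            d + y * v ≡ x * u → ∀ K → CombinesEventually d u v K
bézout-combinesEventually {d} {x = x} {y} (divides a refl) (divides b refl) eq =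
  coprime-combinesEventually {a} {b} {x} {y} d (*-cancelʳ-≡ (1 + y * b) (x * a) d (begin
    (1 + y * b) * d   ≡⟨ unfold y b d ⟩
    d + y * (b * d)   ≡⟨ eq ⟩
    x * (a * d)       ≡⟨ *-assoc x a d ⟨
    x * a * d         ∎))
  where
  open ≡-Reasoning
  instance
    b≢0 : NonZero b
    b≢0 = m*n≢0⇒m≢0 b
    d≢0 : NonZero d
    d≢0 = m*n≢0⇒n≢0 b
  unfold : ∀ y b d → (1 + y * b) * d ≡ d + y * (b * d)
  unfold = solve-∀

gcd-combinesEventually : ∀ u v K → CombinesEventually (gcd u v) u v K
gcd-combinesEventually u zero K =
  K , λ t K<t → t , suc K , K<t , ≤-refl ,
        trans (cong (t *_) (gcd-identityʳ u))
              (sym (trans (cong (t * u +_) (*-zeroʳ (suc K))) (+-identityʳ (t * u))))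
gcd-combinesEventually zero v@(suc _) K =
  K , λ t K<t → suc K , t , ≤-refl , K<t ,
        trans (cong (t *_) (gcd-identityˡ v)) (cong (_+ t * v) (sym (*-zeroʳ (suc K))))
gcd-combinesEventually u@(suc _) v@(suc _) K with Bézout.identity (gcd-GCD u v)
... | Bézout.+- x y eq = bézout-combinesEventually {x = x} {y} (gcd[m,n]∣m u v) (gcd[m,n]∣n u v) eq K
... | Bézout.-+ x y eq =
  combinesEventually-comm (bézout-combinesEventually {x = y} {x} (gcd[m,n]∣n u v) (gcd[m,n]∣m u v) eq K)

multiples-of-gcd-representable : ∀ S → ∃ λ B → ∀ t → B < t → Representable S (t * gcdList S)
multiples-of-gcd-representable [] = 0 , λ t _ → [] , sym (*-zeroʳ t)
multiples-of-gcd-representable (s ∷ S) with multiples-of-gcd-representable S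
... | B , representable with gcd-combinesEventually s (gcdList S) B
... | N , combines = N , extend
  where
  extend : ∀ t → N < t → Representable (s ∷ S) (t * gcdList (s ∷ S))
  extend t N<t with combines t N<t
  ... | α , β , _ , B<β , eq with representable β B<β
  ...   | c , βg≡ = α ∷ c , trans (cong (α * s +_) βg≡) (sym eq)

largest-counterexample : ∀ {P : ℕ → Set} → Decidable P → ∀ {A B} → ¬ P A → (∀ t → B < t → P t) →
                         ∃ λ G → A ≤ G × ¬ P G × (∀ t → G < t → P t)
largest-counterexample {P} P? {A} {B} ¬PA beyondB =
  search B λ t A+B<t → beyondB t (≤-trans (s≤s (m≤n+m B A)) A+B<t)
  where
  search : ∀ k → (∀ t → A + k < t → P t) → ∃ λ G → A ≤ G × ¬ P G × (∀ t → G < t → P t)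
  search k beyond with P? (A + k)
  search k       beyond | no ¬P = A + k , m≤m+n A k , ¬P , beyond
  search zero    beyond | yes PA = contradiction (subst P (+-identityʳ A) PA) ¬PA
  search (suc k) beyond | yes P[A+k+1] = search k beyond′
    where
    beyond′ : ∀ t → A + k < t → P t
    beyond′ t A+k<t with m≤n⇒m<n∨m≡n (subst (_≤ t) (sym (+-suc A k)) A+k<t)
    ... | inj₁ A+k+1<t = beyond t A+k+1<t
    ... | inj₂ refl    = P[A+k+1]

representable-eventually : ∀ {S} → gcdList S ≡ 1 → ∃ λ B → ∀ t → B < t → Representable S t
representable-eventually {S} gcd≡1 with multiples-of-gcd-representable S
... | B , representable =
  B , λ t B<t → subst (Representable S) (trans (cong (t *_) gcd≡1) (*-identityʳ t)) (representable t B<t)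

representable-above-Frobenius : ∀ {S A} → gcdList S ≡ 1 → (∀ G → IsFrobenius S G → G < A) →
                                Representable S A
representable-above-Frobenius {S} {A} gcd≡1 G<A with representable? S A
... | yes representable = representable
... | no ¬representable
  with largest-counterexample (representable? S) ¬representable (proj₂ (representable-eventually gcd≡1))
...   | G , A≤G , ¬representableG , beyondG =
  contradiction (G<A G (¬representableG , beyondG)) (≤⇒≯ A≤G)

-- Indicators, cuboids and tilings

-- Defined through does alone, so that it computes through Dec-map and _×-dec_.
𝟙 : {P : Set} → Dec P → ℕ
𝟙 p? = if does p? then 1 else 0

𝟙-yes : {P : Set} (p? : Dec P) → P → 𝟙 p? ≡ 1
𝟙-yes (yes _) _ = refl
𝟙-yes (no ¬p) p = contradiction p ¬p

𝟙-no : {P : Set} (p? : Dec P) → ¬ P → 𝟙 p? ≡ 0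
𝟙-no (yes p) ¬p = contradiction p ¬p
𝟙-no (no _)  _  = refl

𝟙-pos : {P : Set} (p? : Dec P) → 0 < 𝟙 p? → P
𝟙-pos (yes p) _ = p

𝟙≤1 : {P : Set} (p? : Dec P) → 𝟙 p? ≤ 1
𝟙≤1 (true  because _) = ≤-refl
𝟙≤1 (false because _) = z≤n

𝟙-× : {P Q : Set} (p? : Dec P) (q? : Dec Q) → 𝟙 (p? ×-dec q?) ≡ 𝟙 p? * 𝟙 q?
𝟙-× (true  because _) (true  because _) = refl
𝟙-× (true  because _) (false because _) = refl
𝟙-× (false because _) _                 = refl

_∈[_,+_⟩ : ℕ → ℕ → ℕ → Set
t ∈[ h ,+ H ⟩ = h ≤ t × t < h + H

_∈[_,+_⟩? : ∀ t h H → Dec (t ∈[ h ,+ H ⟩)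
t ∈[ h ,+ H ⟩? = (h ≤? t) ×-dec (t <? h + H)

𝟙-below-split : ∀ h H t → 𝟙 (t <? h) + 𝟙 (t ∈[ h ,+ H ⟩?) ≡ 𝟙 (t <? h + H)
𝟙-below-split h H t with t <? h | t <? h + H
... | yes t<h | _ =
  trans (cong₂ _+_ (𝟙-yes (t <? h) t<h) (𝟙-no (t ∈[ h ,+ H ⟩?) λ (h≤t , _) → <⇒≱ t<h h≤t))
        (sym (𝟙-yes (t <? h + H) (≤-trans t<h (m≤m+n h H))))
... | no t≮h | yes t<h+H =
  trans (cong₂ _+_ (𝟙-no (t <? h) t≮h) (𝟙-yes (t ∈[ h ,+ H ⟩?) (≮⇒≥ t≮h , t<h+H)))
        (sym (𝟙-yes (t <? h + H) t<h+H))
... | no t≮h | no t≮h+H =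
  trans (cong₂ _+_ (𝟙-no (t <? h) t≮h) (𝟙-no (t ∈[ h ,+ H ⟩?) (t≮h+H ∘ proj₂)))
        (sym (𝟙-no (t <? h + H) t≮h+H))

𝟙-interval-split : ∀ h H₁ H₂ t →
                   𝟙 (t ∈[ h ,+ H₁ ⟩?) + 𝟙 (t ∈[ h + H₁ ,+ H₂ ⟩?) ≡ 𝟙 (t ∈[ h ,+ H₁ + H₂ ⟩?)
𝟙-interval-split h H₁ H₂ t = +-cancelˡ-≡ (𝟙 (t <? h)) _ _ (begin
  𝟙 (t <? h) + (𝟙 (t ∈[ h ,+ H₁ ⟩?) + upper) ≡⟨ +-assoc (𝟙 (t <? h)) _ upper ⟨
  𝟙 (t <? h) + 𝟙 (t ∈[ h ,+ H₁ ⟩?) + upper   ≡⟨ cong (_+ upper) (𝟙-below-split h H₁ t) ⟩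
  𝟙 (t <? h + H₁) + upper                    ≡⟨ 𝟙-below-split (h + H₁) H₂ t ⟩
  𝟙 (t <? h + H₁ + H₂)                       ≡⟨ cong (λ e → 𝟙 (t <? e)) (+-assoc h H₁ H₂) ⟩
  𝟙 (t <? h + (H₁ + H₂))                     ≡⟨ 𝟙-below-split h (H₁ + H₂) t ⟨
  𝟙 (t <? h) + 𝟙 (t ∈[ h ,+ H₁ + H₂ ⟩?)      ∎)
  where
  open ≡-Reasoning
  upper : ℕ
  upper = 𝟙 (t ∈[ h + H₁ ,+ H₂ ⟩?)

𝟙-empty-interval : ∀ h t → 𝟙 (t ∈[ h ,+ 0 ⟩?) ≡ 0
𝟙-empty-interval h t =
  𝟙-no (t ∈[ h ,+ 0 ⟩?) λ (h≤t , t<h+0) → <⇒≱ (subst (t <_) (+-identityʳ h) t<h+0) h≤t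

count : {A : Set} {Q : A → Set} → Decidable Q → List A → ℕ
count Q? L = sum (map (λ a → 𝟙 (Q? a)) L)

module _ {A : Set} {Q : A → Set} (Q? : Decidable Q) where

  count-++ : (L₁ L₂ : List A) → count Q? (L₁ ++ L₂) ≡ count Q? L₁ + count Q? L₂
  count-++ L₁ L₂ = trans (cong sum (map-++ (λ a → 𝟙 (Q? a)) L₁ L₂)) (sum-++ (map _ L₁) _)

  count-lookup : ∀ L t → Q (lookup L t) → 0 < count Q? L
  count-lookup (a ∷ L) zero    q = subst (λ z → 0 < z + count Q? L) (sym (𝟙-yes (Q? a) q)) (s≤s z≤n)
  count-lookup (a ∷ L) (suc t) q = ≤-trans (count-lookup L t q) (m≤n+m (count Q? L) (𝟙 (Q? a)))

  count>0⇒lookup : ∀ L → 0 < count Q? L → ∃ λ t → Q (lookup L t)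
  count>0⇒lookup (a ∷ L) pos with Q? a
  ... | yes q = zero , q
  ... | no _  = let t , q = count>0⇒lookup L pos in suc t , q

  two-hits⇒count>1 : ∀ {a} L u → Q a → Q (lookup L u) → 1 < count Q? (a ∷ L)
  two-hits⇒count>1 {a} L u qa qu =
    subst (λ z → 1 < z + count Q? L) (sym (𝟙-yes (Q? a) qa)) (s≤s (count-lookup L u qu))

  count≤1⇒lookup-unique : ∀ L t u → count Q? L ≤ 1 → Q (lookup L t) → Q (lookup L u) → t ≡ u
  count≤1⇒lookup-unique (a ∷ L) zero    zero    _  _  _  = refl
  count≤1⇒lookup-unique (a ∷ L) zero    (suc u) ≤1 qt qu =
    contradiction ≤1 (<⇒≱ (two-hits⇒count>1 L u qt qu))
  count≤1⇒lookup-unique (a ∷ L) (suc t) zero    ≤1 qt qu =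
    contradiction ≤1 (<⇒≱ (two-hits⇒count>1 L t qu qt))
  count≤1⇒lookup-unique (a ∷ L) (suc t) (suc u) ≤1 qt qu =
    cong suc (count≤1⇒lookup-unique L t u (≤-trans (m≤n+m (count Q? L) (𝟙 (Q? a))) ≤1) qt qu)

Cell : ℕ → Set
Cell m = Fin m → ℕ

record Cuboid (m : ℕ) : Set where
  constructor cuboid
  field
    corner : Cell m
    size   : Fin m → ℕ
open Cuboid

tailᶜ : ∀ {m} → Cuboid (suc m) → Cuboid m
tailᶜ C = cuboid (tail (corner C)) (tail (size C))

prism : ∀ {m} → ℕ → ℕ → Cuboid m → Cuboid (suc m)
prism h H R = cuboid (h Vec.∷ corner R) (H Vec.∷ size R)

box : ∀ {m} → (Fin m → ℕ) → Cuboid m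
box a = cuboid (λ _ → 0) a

_∈ᶜ_ : ∀ {m} → Cell m → Cuboid m → Set
c ∈ᶜ C = ∀ j → c j ∈[ corner C j ,+ size C j ⟩

_∈ᶜ?_ : ∀ {m} (c : Cell m) (C : Cuboid m) → Dec (c ∈ᶜ C)
_∈ᶜ?_ {zero}  c C = yes λ ()
_∈ᶜ?_ {suc m} c C =
  Dec-map ∀-cons-⇔ ((c zero ∈[ corner C zero ,+ size C zero ⟩?) ×-dec (tail c ∈ᶜ? tailᶜ C))

𝟙-∈-prism : ∀ {m} h H (R : Cuboid m) (c : Cell (suc m)) →
            𝟙 (c ∈ᶜ? prism h H R) ≡ 𝟙 (c zero ∈[ h ,+ H ⟩?) * 𝟙 (tail c ∈ᶜ? R)
𝟙-∈-prism h H R c = 𝟙-× (c zero ∈[ h ,+ H ⟩?) (tail c ∈ᶜ? R)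

far-corner : ∀ {m} → Cuboid m → Cell m
far-corner C j = corner C j + (size C j ∸ 1)

far-corner-∈ : ∀ {m} (C : Cuboid m) → (∀ j → 0 < size C j) → far-corner C ∈ᶜ C
far-corner-∈ C pos j = m≤m+n (corner C j) _ , last<end (corner C j) (pos j)
  where
  last<end : ∀ k {s} → 0 < s → k + (s ∸ 1) < k + s
  last<end k {suc s} _ = +-monoʳ-< k ≤-refl

far-corner∈box⇒bounded : ∀ {m} (C : Cuboid m) {a} → (∀ j → 0 < size C j) → far-corner C ∈ᶜ box a →
                         ∀ j → corner C j + size C j ≤ a j
far-corner∈box⇒bounded C pos far∈ j = end≤ (corner C j) (pos j) (proj₂ (far∈ j))
  where
  end≤ : ∀ k {s a} → 0 < s → k + (s ∸ 1) < a → k + s ≤ a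
  end≤ k {suc s} {a} _ lt = subst (_≤ a) (sym (+-suc k s)) lt

Placement : Set → ℕ → Set
Placement B m = Cell m × B

place : ∀ {B m} → (Fin m → B → ℕ) → Placement B m → Cuboid m
place y (k , b) = cuboid k (λ j → y j b)

coverage : ∀ {B m} → (Fin m → B → ℕ) → List (Placement B m) → Cell m → ℕ
coverage y L c = count (λ P → c ∈ᶜ? place y P) L

IsTiling : ∀ {B m} → (Fin m → B → ℕ) → List (Placement B m) → Cuboid m → Set
IsTiling y L R = ∀ c → coverage y L c ≡ 𝟙 (c ∈ᶜ? R)

module _ {B : Set} {m : ℕ} (y : Fin m → B → ℕ) (L : List (Placement B m)) {R : Cuboid m}
         (T : IsTiling y L R) where

  tiling-piece⊆region : ∀ t c → c ∈ᶜ place y (lookup L t) → c ∈ᶜ R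
  tiling-piece⊆region t c c∈ =
    𝟙-pos (c ∈ᶜ? R) (subst (0 <_) (T c) (count-lookup (λ P → c ∈ᶜ? place y P) L t c∈))

  tiling-covers : ∀ c → c ∈ᶜ R → ∃ λ t → c ∈ᶜ place y (lookup L t)
  tiling-covers c c∈ =
    count>0⇒lookup (λ P → c ∈ᶜ? place y P) L
      (subst (0 <_) (sym (trans (T c) (𝟙-yes (c ∈ᶜ? R) c∈))) (s≤s z≤n))

  tiling-disjoint : ∀ c t u → c ∈ᶜ place y (lookup L t) → c ∈ᶜ place y (lookup L u) → t ≡ u
  tiling-disjoint c t u =
    count≤1⇒lookup-unique (λ P → c ∈ᶜ? place y P) L t u
      (subst (_≤ 1) (sym (T c)) (𝟙≤1 (c ∈ᶜ? R)))

module _ {B : Set} {m : ℕ} (y : Fin (suc m) → B → ℕ) where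

  tiling-stack : ∀ {L₁ L₂ h H₁ H₂} {R : Cuboid m} →
                 IsTiling y L₁ (prism h H₁ R) → IsTiling y L₂ (prism (h + H₁) H₂ R) →
                 IsTiling y (L₁ ++ L₂) (prism h (H₁ + H₂) R)
  tiling-stack {L₁} {L₂} {h} {H₁} {H₂} {R} T₁ T₂ c = begin
    coverage y (L₁ ++ L₂) c                           ≡⟨ count-++ (λ P → c ∈ᶜ? place y P) L₁ L₂ ⟩
    coverage y L₁ c + coverage y L₂ c                 ≡⟨ cong₂ _+_ (T₁ c) (T₂ c) ⟩
    𝟙 (c ∈ᶜ? prism h H₁ R) + 𝟙 (c ∈ᶜ? prism (h + H₁) H₂ R)
                                                      ≡⟨ cong₂ _+_ (𝟙-∈-prism h H₁ R c) (𝟙-∈-prism (h + H₁) H₂ R c) ⟩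
    𝟙 I₁ * 𝟙 R? + 𝟙 I₂ * 𝟙 R?                         ≡⟨ *-distribʳ-+ (𝟙 R?) (𝟙 I₁) (𝟙 I₂) ⟨
    (𝟙 I₁ + 𝟙 I₂) * 𝟙 R?                              ≡⟨ cong (_* 𝟙 R?) (𝟙-interval-split h H₁ H₂ (c zero)) ⟩
    𝟙 (c zero ∈[ h ,+ H₁ + H₂ ⟩?) * 𝟙 R?              ≡⟨ 𝟙-∈-prism h (H₁ + H₂) R c ⟨
    𝟙 (c ∈ᶜ? prism h (H₁ + H₂) R)                     ∎
    where
    open ≡-Reasoning
    I₁ : Dec (c zero ∈[ h ,+ H₁ ⟩)
    I₁ = c zero ∈[ h ,+ H₁ ⟩?
    I₂ : Dec (c zero ∈[ h + H₁ ,+ H₂ ⟩)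
    I₂ = c zero ∈[ h + H₁ ,+ H₂ ⟩?
    R? : Dec (tail c ∈ᶜ R)
    R? = tail c ∈ᶜ? R

  SlabTileable : Cuboid m → ℕ → Set
  SlabTileable R H = ∀ h → ∃ λ L → IsTiling y L (prism h H R)

  slab-0 : ∀ {R} → SlabTileable R 0
  slab-0 {R} h = [] , λ c → sym (begin
    𝟙 (c ∈ᶜ? prism h 0 R)                      ≡⟨ 𝟙-∈-prism h 0 R c ⟩
    𝟙 (c zero ∈[ h ,+ 0 ⟩?) * 𝟙 (tail c ∈ᶜ? R) ≡⟨ cong (_* _) (𝟙-empty-interval h (c zero)) ⟩
    0                                          ∎)
    where open ≡-Reasoning

  slab-+ : ∀ {R H₁ H₂} → SlabTileable R H₁ → SlabTileable R H₂ → SlabTileable R (H₁ + H₂)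
  slab-+ {R} {H₁} {H₂} S₁ S₂ h =
    let L₁ , T₁ = S₁ h
        L₂ , T₂ = S₂ (h + H₁)
    in L₁ ++ L₂ , tiling-stack {L₁} {L₂} {h} {H₁} {H₂} {R} T₁ T₂

  slab-* : ∀ {R H} q → SlabTileable R H → SlabTileable R (q * H)
  slab-* zero    S = slab-0
  slab-* (suc q) S = slab-+ S (slab-* q S)

  slab-combination : ∀ {R S} → All (SlabTileable R) S → ∀ c → SlabTileable R (sum (zipWith _*_ c S))
  slab-combination []       []       = slab-0
  slab-combination []       (_ ∷ _)  = slab-0
  slab-combination (_ ∷ _)  []       = slab-0
  slab-combination (S ∷ Ss) (c ∷ cs) = slab-+ (slab-* c S) (slab-combination Ss cs)

  slab-representable : ∀ {R S t} → All (SlabTileable R) S → Representable S t → SlabTileable R t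
  slab-representable Ss (c , refl) = slab-combination Ss c

  -- The brick placed at corner h ∷ k is, definitionally, the slab of height y zero b over its base.
  brick-slab : ∀ k b → SlabTileable (cuboid k (λ j → y (suc j) b)) (y zero b)
  brick-slab k b h = (h Vec.∷ k , b) ∷ [] , λ c → +-identityʳ _

  module _ {B′ : Set} (y′ : Fin m → B′ → ℕ) where

    coverage-columns : ∀ {h H} (T : Placement B′ m → List (Placement B (suc m))) →
                       (∀ P → IsTiling y (T P) (prism h H (place y′ P))) →
                       ∀ L c →
                       coverage y (concatMap T L) c ≡ 𝟙 (c zero ∈[ h ,+ H ⟩?) * coverage y′ L (tail c)
    coverage-columns {h} {H} T T-tiles [] c = sym (*-zeroʳ (𝟙 (c zero ∈[ h ,+ H ⟩?)))
    coverage-columns {h} {H} T T-tiles (P ∷ L) c = begin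
      coverage y (T P ++ concatMap T L) c                 ≡⟨ count-++ (λ Q → c ∈ᶜ? place y Q) (T P) _ ⟩
      coverage y (T P) c + coverage y (concatMap T L) c   ≡⟨ cong₂ _+_ (T-tiles P c) (columns L) ⟩
      𝟙 (c ∈ᶜ? prism h H (place y′ P)) + 𝟙 I * rest       ≡⟨ cong (_+ 𝟙 I * rest) (𝟙-∈-prism h H (place y′ P) c) ⟩
      𝟙 I * 𝟙 (tail c ∈ᶜ? place y′ P) + 𝟙 I * rest        ≡⟨ *-distribˡ-+ (𝟙 I) _ rest ⟨
      𝟙 I * coverage y′ (P ∷ L) (tail c)                  ∎
      where
      open ≡-Reasoning
      I : Dec (c zero ∈[ h ,+ H ⟩)
      I = c zero ∈[ h ,+ H ⟩?
      rest : ℕ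
      rest = coverage y′ L (tail c)
      columns : ∀ L → coverage y (concatMap T L) c ≡ 𝟙 I * coverage y′ L (tail c)
      columns L = coverage-columns {h} {H} T T-tiles L c

    slab-over-tiling : ∀ {L R H} → IsTiling y′ L R → (∀ P → SlabTileable (place y′ P) H) →
                       SlabTileable R H
    slab-over-tiling {L} {R} {H} T S h = concatMap (λ P → proj₁ (S P h)) L , λ c → begin
      coverage y (concatMap (λ P → proj₁ (S P h)) L) c ≡⟨ coverage-columns {h} {H} _ (λ P → proj₂ (S P h)) L c ⟩
      𝟙 (c zero ∈[ h ,+ H ⟩?) * coverage y′ L (tail c) ≡⟨ cong (𝟙 (c zero ∈[ h ,+ H ⟩?) *_) (T (tail c)) ⟩
      𝟙 (c zero ∈[ h ,+ H ⟩?) * 𝟙 (tail c ∈ᶜ? R)      ≡⟨ 𝟙-∈-prism h H R c ⟨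
      𝟙 (c ∈ᶜ? prism h H R)                            ∎
      where open ≡-Reasoning

-- Tiling boxes by induction on the dimension

-- Xset x k I is definitionally cofactors (toℕ k) (x k ∘ I).
cofactors : (k : ℕ) → (Fin (suc (suc k)) → ℕ) → List ℕ
cofactors k f = map (λ r → prodFin (suc k) (f ∘ punchIn r)) (allFin (suc (suc k)))

Admissible : (m : ℕ) → (Fin m → Fin (suc m) → ℕ) → (Fin m → ℕ) → Set
Admissible zero    y a = ⊤
Admissible (suc m) y a =
  Representable (cofactors m (y zero)) (a zero) ×
  (∀ r → Admissible m (λ j s → y (suc j) (punchIn r s)) (tail a))

factor∣prodFin : ∀ k (f : Fin k → ℕ) i → f i ∣ prodFin k f
factor∣prodFin (suc k) f zero    = m∣m*n (prodFin k (f ∘ suc))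
factor∣prodFin (suc k) f (suc i) = ∣-trans (factor∣prodFin k (f ∘ suc) i) (n∣m*n (f zero))

-- In the second clause, prism 0 (a zero) (box (tail a)) and box a have the same membership
-- test definitionally.
box-tiling : ∀ m (y : Fin m → Fin (suc m) → ℕ) (a : Fin m → ℕ) → Admissible m y a →
             ∃ λ L → IsTiling y L (box a)
box-tiling zero    y a _ = ((λ ()) , zero) ∷ [] , λ c → refl
box-tiling (suc m) y a (representable , admissible) =
  slab-representable y (All.map⁺ (All.tabulate⁺ slab)) representable 0
  where
  slab : ∀ r → SlabTileable y (box (tail a)) (prodFin (suc m) (y zero ∘ punchIn r))
  slab r = let L , T = box-tiling m y′ (tail a) (admissible r) in slab-over-tiling y y′ {L} T column
    where
    y′ : Fin m → Fin (suc m) → ℕ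
    y′ j s = y (suc j) (punchIn r s)
    column : ∀ P → SlabTileable y (place y′ P) (prodFin (suc m) (y zero ∘ punchIn r))
    column (k , s) with factor∣prodFin (suc m) (y zero ∘ punchIn r) s
    ... | divides q eq =
      subst (SlabTileable y (place y′ (k , s))) (sym eq) (slab-* y q (brick-slab y k (punchIn r s)))

CofactorsRepresent : ∀ {N} → (Fin N → ℕ) → ℕ → ℕ → Set
CofactorsRepresent {N} f k A =
  ∀ (I : Fin (suc (suc k)) → Fin N) → StrictlyIncreasing I → Representable (cofactors k (f ∘ I)) A

punchIn-mono-< : ∀ {n} (r : Fin (suc n)) (i j : Fin n) → i <ᶠ j → punchIn r i <ᶠ punchIn r j
punchIn-mono-< zero    i       j       i<j       = s≤s i<j
punchIn-mono-< (suc r) zero    (suc j) _         = s≤s z≤n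
punchIn-mono-< (suc r) (suc i) (suc j) (s≤s i<j) = s≤s (punchIn-mono-< r i j i<j)

cofactorsRepresent-punchIn : ∀ {N f k A} → CofactorsRepresent {suc N} f k A →
                             ∀ r → CofactorsRepresent (f ∘ punchIn r) k A
cofactorsRepresent-punchIn represent r I I↑ =
  represent (punchIn r ∘ I) λ i j i<j → punchIn-mono-< r (I i) (I j) (I↑ i j i<j)

-- Admissible splits off axis zero, which has to be the paper's last axis: the one whose
-- hypothesis involves all the bricks.
admissible-opposite : ∀ m (y : Fin m → Fin (suc m) → ℕ) (a : Fin m → ℕ) →
                      (∀ j → CofactorsRepresent (y j) (toℕ j) (a j)) →
                      Admissible m (λ j → y (opposite j)) (λ j → a (opposite j))
admissible-opposite zero    y a _         = tt
admissible-opposite (suc m) y a represent = last id (λ _ _ i<j → i<j) , rest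
  where
  represent′ : ∀ j {k} → toℕ j ≡ k → CofactorsRepresent (y j) k (a j)
  represent′ j refl = represent j
  last : CofactorsRepresent (y (fromℕ m)) m (a (fromℕ m))
  last = represent′ (fromℕ m) (toℕ-fromℕ m)
  rest : ∀ r → Admissible m (λ j s → y (inject₁ (opposite j)) (punchIn r s))
                             (λ j → a (inject₁ (opposite j)))
  rest r = admissible-opposite m (λ j s → y (inject₁ j) (punchIn r s)) (a ∘ inject₁) λ j →
    cofactorsRepresent-punchIn {f = y (inject₁ j)} (represent′ (inject₁ j) (toℕ-inject₁ j)) r

module _ {n} (x : Fin n → Fin (suc n) → ℕ) where

  toPlaced : Placement (Fin (suc n)) n → Placed n
  toPlaced (k , b) = record { brick = b ; rot = Permutation.id ; corner = k ∘ opposite }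

  cellIn⇒∈ᶜ : ∀ P c → CellIn x (toPlaced P) c → (c ∘ opposite) ∈ᶜ place (x ∘ opposite) P
  cellIn⇒∈ᶜ (k , b) c c∈ j =
    subst (λ i → c (opposite j) ∈[ k i ,+ x (opposite j) b ⟩) (opposite-involutive j) (c∈ (opposite j))

  ∈ᶜ⇒cellIn : ∀ P c → (c ∘ opposite) ∈ᶜ place (x ∘ opposite) P → CellIn x (toPlaced P) c
  ∈ᶜ⇒cellIn (k , b) c c∈ j =
    subst (λ i → c i ∈[ k (opposite j) ,+ x i b ⟩) (opposite-involutive j) (c∈ (opposite j))

  tiles-opposite : (∀ j i → 0 < x j i) → ∀ a L → IsTiling (x ∘ opposite) L (box (a ∘ opposite)) →
                   Tiles x a (length L) (toPlaced ∘ lookup L)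
  tiles-opposite x>0 a L T = inside , covered , disjoint
    where
    inside : ∀ t j → Placed.corner (toPlaced (lookup L t)) j + side x (toPlaced (lookup L t)) j ≤ a j
    inside t j = subst (λ i → k (opposite j) + x i b ≤ a i) (opposite-involutive j) (bounded (opposite j))
      where
      k : Cell n
      k = proj₁ (lookup L t)
      b : Fin (suc n)
      b = proj₂ (lookup L t)
      C : Cuboid n
      C = place (x ∘ opposite) (lookup L t)
      pos : ∀ j → 0 < size C j
      pos j = x>0 (opposite j) b
      bounded : ∀ j → k j + x (opposite j) b ≤ a (opposite j)
      bounded = far-corner∈box⇒bounded C pos
                  (tiling-piece⊆region (x ∘ opposite) L T t (far-corner C) (far-corner-∈ C pos))
    covered : ∀ c → (∀ j → c j < a j) → ∃ λ t → CellIn x (toPlaced (lookup L t)) c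
    covered c c<a =
      let t , c∈ = tiling-covers (x ∘ opposite) L T (c ∘ opposite) λ j → z≤n , c<a (opposite j)
      in t , ∈ᶜ⇒cellIn (lookup L t) c c∈
    disjoint : ∀ c t u → CellIn x (toPlaced (lookup L t)) c → CellIn x (toPlaced (lookup L u)) c → t ≡ u
    disjoint c t u c∈t c∈u = tiling-disjoint (x ∘ opposite) L T (c ∘ opposite) t u
                               (cellIn⇒∈ᶜ (lookup L t) c c∈t) (cellIn⇒∈ᶜ (lookup L u) c c∈u)

theorem2p1 : (n : ℕ) → 1 ≤ n →
    (x : Fin n → Fin (suc n) → ℕ) →
    (∀ j i → 2 ≤ x j i) →
    (∀ (kk : Fin n) (I : Fin (suc (suc (toℕ kk))) → Fin (suc n)) →
       StrictlyIncreasing I → gcdList (Xset x kk I) ≡ 1) →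
    (a : Fin n → ℕ) →
    (∀ j → 0 < a j) →
    (∀ (j : Fin n) (kk : Fin n) (I : Fin (suc (suc (toℕ kk))) → Fin (suc n)) (G : ℕ) →
       StrictlyIncreasing I → IsFrobenius (Xset x kk I) G → G < a j) →
    Tileable x a
theorem2p1 n _ x x≥2 gcd≡1 a _ G<a =
  let L , T = box-tiling n (x ∘ opposite) (a ∘ opposite) (admissible-opposite n x a represent)
  in length L , toPlaced x ∘ lookup L , tiles-opposite x (λ j i → <-≤-trans (s≤s z≤n) (x≥2 j i)) a L T
  where
  represent : ∀ j → CofactorsRepresent (x j) (toℕ j) (a j)
  represent j I I↑ = representable-above-Frobenius (gcd≡1 j I I↑) λ G → G<a j j I G I↑
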